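{- The image under $\mathbf{push}$ of the set $\mathcal{I}(010,102)$ of all inversion sequences avoiding $010$ and $102$ is exactly $\mathfrak A\setminus\{\varepsilon\}$.
   Context: An inversion sequence of size $n$ is a sequence $\sigma=(\sigma_1,\dots,\sigma_n)$ of integers with $\sigma_i\in\{0,\dots,i-1\}$; $\varepsilon$ is the empty sequence. A sequence contains $010$ if it has entries at positions $a<b<c$ with $\sigma_a=\sigma_c<\sigma_b$, and contains $102$ if it has entries at positions $a<b<c$ with $\sigma_b<\sigma_a<\sigma_c$; otherwise it avoids them. $\mathfrak A$ is the set of inversion sequences (of any size $\geqslant 0$) which avoid $010$ and $102$ and do not contain any entry equal to $1$. For an inversion sequence $\sigma$ of size $n$, $\mathbf{push}(\sigma)=0\cdot(\sigma_i+\chi(\sigma_i>0))_{i\in[1,n]}$, i.e. the sequence obtained by adding $1$ to every nonzero entry of $\sigma$ and inserting a $0$ at the beginning ($\chi$ is the indicator function). -}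

module Defs where

open import Data.Nat using (ℕ; zero; suc; _<_)
open import Data.List using (List; []; _∷_; length; map; lookup)
open import Data.Fin using (Fin; toℕ) renaming (_<_ to _<ᶠ_)
open import Data.Product using (Σ; _×_; ∃-syntax)
open import Relation.Binary.PropositionalEquality using (_≡_)
open import Relation.Nullary using (¬_)

-- Position i (0-based index in Fin (length σ)) corresponds to the 1-based
-- position i+1, so the condition σ_{i+1} ∈ {0,…,i} reads  σ[i] < i+1.
IsInvSeq : List ℕ → Set
IsInvSeq σ = (i : Fin (length σ)) → lookup σ i < suc (toℕ i)

Contains010 : List ℕ → Set
Contains010 σ = ∃[ a ] ∃[ b ] ∃[ c ]
  (a <ᶠ b × b <ᶠ c × lookup σ a ≡ lookup σ c × lookup σ c < lookup σ b)

Contains102 : List ℕ → Set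
Contains102 σ = ∃[ a ] ∃[ b ] ∃[ c ]
  (a <ᶠ b × b <ᶠ c × lookup σ b < lookup σ a × lookup σ a < lookup σ c)

InI010-102 : List ℕ → Set
InI010-102 σ = IsInvSeq σ × ¬ Contains010 σ × ¬ Contains102 σ

InFrakA : List ℕ → Set
InFrakA σ = InI010-102 σ × ((i : Fin (length σ)) → ¬ (lookup σ i ≡ 1))

bump : ℕ → ℕ
bump zero = zero
bump (suc k) = suc (suc k)

push : List ℕ → List ℕ
push σ = 0 ∷ map bump σ

{-# OPTIONS --safe #-}
-- bump is strictly increasing, so occurrences of 010 and 102 transfer between σ and map bump σ
-- in both directions.  The 0 that push prepends creates no 102 (nothing lies below 0) and no new
-- 010: an inversion sequence already starts with 0, and of two equal leading entries at most one
-- takes part in a 010.  Conversely an element of 𝔄 starts with 0 and has no entry 1, so dropping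
-- that 0 and decrementing the positive entries inverts push.
module Submission where

open import Defs
open import Data.Nat using (ℕ; zero; suc; _+_; _<_; z<s; s<s; s<s⁻¹)
open import Data.Nat.Properties using (<-cmp; <-irrefl; <-asym; n<1⇒n≡0)
open import Data.List using (List; []; _∷_; length; map; lookup)
open import Data.List.Properties using (length-map)
open import Data.Fin using (Fin; toℕ; zero; suc; cast) renaming (_<_ to _<ᶠ_)
open import Data.Fin.Properties using (toℕ-cast)
open import Data.Product using (_×_; ∃-syntax; _,_; proj₁)
open import Function using (_∘_; _∘′_)
open import Function.Bundles using (_⇔_; mk⇔; Equivalence)
open import Relation.Binary using (tri<; tri≈; tri>)
open import Relation.Binary.Core using (_Preserves_⟶_)
open import Relation.Binary.PropositionalEquality
  using (_≡_; _≢_; refl; sym; cong; cong₂; subst; subst₂)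
open import Relation.Nullary using (¬_; contradiction)

private
  variable
    A B : Set
    x : ℕ
    xs σ : List ℕ

lookup-map : (f : A → B) (as : List A) (i : Fin (length (map f as))) →
             lookup (map f as) i ≡ f (lookup as (cast (length-map f as) i))
lookup-map f (a ∷ as) zero    = refl
lookup-map f (a ∷ as) (suc i) = lookup-map f as i

lookup-map-cast : (f : A → B) (as : List A) (i : Fin (length as)) →
                  lookup (map f as) (cast (sym (length-map f as)) i) ≡ f (lookup as i)
lookup-map-cast f (a ∷ as) zero    = refl
lookup-map-cast f (a ∷ as) (suc i) = lookup-map-cast f as i

cast-mono : ∀ {m n} .(eq : m ≡ n) {i j : Fin m} → i <ᶠ j → cast eq i <ᶠ cast eq j
cast-mono eq {i} {j} = subst₂ _<_ (sym (toℕ-cast eq i)) (sym (toℕ-cast eq j))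

module StrictlyMonotone {f : ℕ → ℕ} (f-mono : f Preserves _<_ ⟶ _<_) where

  reflects-< : ∀ {m n} → f m < f n → m < n
  reflects-< {m} {n} fm<fn with <-cmp m n
  ... | tri< m<n _ _ = m<n
  ... | tri≈ _ refl _ = contradiction fm<fn (<-irrefl refl)
  ... | tri> _ _ n<m = contradiction fm<fn (<-asym (f-mono n<m))

  injective : ∀ {m n} → f m ≡ f n → m ≡ n
  injective {m} {n} fm≡fn with <-cmp m n
  ... | tri< m<n _ _ = contradiction (f-mono m<n) (<-irrefl fm≡fn)
  ... | tri≈ _ m≡n _ = m≡n
  ... | tri> _ _ n<m = contradiction (f-mono n<m) (<-irrefl (sym fm≡fn))

-- xs occurs in ys as a pattern: as ℕ is totally ordered, preserving < and ≡ makes the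
-- subsequence of ys selected by embed order-isomorphic to xs.
record _≼_ (xs ys : List ℕ) : Set where
  field
    embed      : Fin (length xs) → Fin (length ys)
    embed-mono : ∀ {i j} → i <ᶠ j → embed i <ᶠ embed j
    embed-<    : ∀ {i j} → lookup xs i < lookup xs j → lookup ys (embed i) < lookup ys (embed j)
    embed-≡    : ∀ {i j} → lookup xs i ≡ lookup xs j → lookup ys (embed i) ≡ lookup ys (embed j)

module _ {xs ys : List ℕ} (xs≼ys : xs ≼ ys) where
  open _≼_ xs≼ys

  ≼-Contains010 : Contains010 xs → Contains010 ys
  ≼-Contains010 (a , b , c , a<b , b<c , a≡c , c<b) =
    embed a , embed b , embed c , embed-mono a<b , embed-mono b<c , embed-≡ a≡c , embed-< c<b

  ≼-Contains102 : Contains102 xs → Contains102 ys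
  ≼-Contains102 (a , b , c , a<b , b<c , b<a , a<c) =
    embed a , embed b , embed c , embed-mono a<b , embed-mono b<c , embed-< b<a , embed-< a<c

module _ {f : ℕ → ℕ} (f-mono : f Preserves _<_ ⟶ _<_) (as : List ℕ) where
  open StrictlyMonotone f-mono

  ≼-map : as ≼ map f as
  ≼-map = record
    { embed      = cast (sym (length-map f as))
    ; embed-mono = cast-mono _
    ; embed-<    = λ {i} {j} → subst₂ _<_ (lookup-image i) (lookup-image j) ∘′ f-mono
    ; embed-≡    = λ {i} {j} → subst₂ _≡_ (lookup-image i) (lookup-image j) ∘′ cong f
    }
    where
    lookup-image : ∀ i → f (lookup as i) ≡ lookup (map f as) (cast (sym (length-map f as)) i)
    lookup-image i = sym (lookup-map-cast f as i)

  map-≼ : map f as ≼ as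
  map-≼ = record
    { embed      = cast (length-map f as)
    ; embed-mono = cast-mono _
    ; embed-<    = λ {i} {j} → reflects-< ∘′ subst₂ _<_ (lookup-map f as i) (lookup-map f as j)
    ; embed-≡    = λ {i} {j} → injective ∘′ subst₂ _≡_ (lookup-map f as i) (lookup-map f as j)
    }

Contains010-∷ : Contains010 xs → Contains010 (x ∷ xs)
Contains010-∷ (a , b , c , a<b , b<c , a≡c , c<b) =
  suc a , suc b , suc c , s<s a<b , s<s b<c , a≡c , c<b

Contains102-∷ : Contains102 xs → Contains102 (x ∷ xs)
Contains102-∷ (a , b , c , a<b , b<c , b<a , a<c) =
  suc a , suc b , suc c , s<s a<b , s<s b<c , b<a , a<c

Contains010-dedup : Contains010 (x ∷ x ∷ xs) → Contains010 (x ∷ xs)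
Contains010-dedup (zero , suc zero , c , _ , _ , a≡c , c<b) =
  contradiction c<b (<-irrefl (sym a≡c))
Contains010-dedup (zero , suc (suc b) , suc (suc c) , _ , b<c , a≡c , c<b) =
  zero , suc b , suc c , z<s , s<s⁻¹ b<c , a≡c , c<b
Contains010-dedup (zero , suc (suc _) , suc zero , _ , s<s () , _)
Contains010-dedup (suc a , suc b , suc c , a<b , b<c , a≡c , c<b) =
  a , b , c , s<s⁻¹ a<b , s<s⁻¹ b<c , a≡c , c<b

Contains102-0∷ : Contains102 (0 ∷ xs) → Contains102 xs
Contains102-0∷ (suc a , suc b , suc c , a<b , b<c , b<a , a<c) =
  a , b , c , s<s⁻¹ a<b , s<s⁻¹ b<c , b<a , a<c

bump-mono : bump Preserves _<_ ⟶ _<_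
bump-mono {zero}  {suc _} _   = z<s
bump-mono {suc _} {suc _} m<n = s<s m<n

bump≢1 : ∀ n → bump n ≢ 1
bump≢1 zero    ()
bump≢1 (suc n) ()

<1+⇔bump<2+ : ∀ {m n} → m < suc n ⇔ bump m < suc (suc n)
<1+⇔bump<2+ {zero}  = mk⇔ (λ _ → z<s) (λ _ → z<s)
<1+⇔bump<2+ {suc m} = mk⇔ s<s s<s⁻¹

unbump : ℕ → ℕ
unbump zero    = zero
unbump (suc n) = n

bump-unbump : ∀ n → n ≢ 1 → bump (unbump n) ≡ n
bump-unbump zero          _   = refl
bump-unbump (suc zero)    n≢1 = contradiction refl n≢1
bump-unbump (suc (suc n)) _   = refl

IsInvSeq-head≡0 : IsInvSeq (x ∷ xs) → x ≡ 0
IsInvSeq-head≡0 inv = n<1⇒n≡0 (inv zero)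

push-IsInvSeq⇔ : IsInvSeq σ ⇔ IsInvSeq (push σ)
push-IsInvSeq⇔ {σ} = mk⇔ to from
  where
  eq : length (map bump σ) ≡ length σ
  eq = length-map bump σ

  to : IsInvSeq σ → IsInvSeq (push σ)
  to inv zero    = z<s
  to inv (suc i) = subst₂ _<_ (sym (lookup-map bump σ i)) (cong (2 +_) (toℕ-cast eq i))
                     (Equivalence.to <1+⇔bump<2+ (inv (cast eq i)))

  from : IsInvSeq (push σ) → IsInvSeq σ
  from inv i = Equivalence.from <1+⇔bump<2+
                 (subst₂ _<_ (lookup-map-cast bump σ i) (cong (2 +_) (toℕ-cast (sym eq) i))
                   (inv (suc (cast (sym eq) i))))

push-Contains010⇔ : IsInvSeq σ → Contains010 σ ⇔ Contains010 (push σ)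
push-Contains010⇔ {σ} inv = mk⇔ (Contains010-∷ ∘ ≼-Contains010 (≼-map bump-mono σ)) (from σ inv)
  where
  from : ∀ σ → IsInvSeq σ → Contains010 (push σ) → Contains010 σ
  from []       _ (zero , zero , _ , () , _)
  from (x ∷ xs) inv with refl ← IsInvSeq-head≡0 inv =
    ≼-Contains010 (map-≼ bump-mono (0 ∷ xs)) ∘ Contains010-dedup

push-Contains102⇔ : Contains102 σ ⇔ Contains102 (push σ)
push-Contains102⇔ {σ} = mk⇔ (Contains102-∷ ∘ ≼-Contains102 (≼-map bump-mono σ))
                            (≼-Contains102 (map-≼ bump-mono σ) ∘ Contains102-0∷)

push-InI010-102⇔ : InI010-102 σ ⇔ InI010-102 (push σ)
push-InI010-102⇔ = mk⇔
  (λ (inv , ∌010 , ∌102) →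
    to push-IsInvSeq⇔ inv , ∌010 ∘ from (push-Contains010⇔ inv) , ∌102 ∘ from push-Contains102⇔)
  (λ (inv , ∌010 , ∌102) → let inv′ = from push-IsInvSeq⇔ inv in
    inv′ , ∌010 ∘ to (push-Contains010⇔ inv′) , ∌102 ∘ to push-Contains102⇔)
  where open Equivalence

push≢1 : (i : Fin (length (push σ))) → lookup (push σ) i ≢ 1
push≢1     zero    ()
push≢1 {σ} (suc i) = subst (_≢ 1) (sym (lookup-map bump σ i)) (bump≢1 _)

map-bump-unbump : ((i : Fin (length xs)) → lookup xs i ≢ 1) → map bump (map unbump xs) ≡ xs
map-bump-unbump {[]}     _   = refl
map-bump-unbump {x ∷ xs} ≢1 = cong₂ _∷_ (bump-unbump x (≢1 zero)) (map-bump-unbump (≢1 ∘ suc))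

push-onto-𝔄 : (τ : List ℕ) → InFrakA τ → τ ≢ [] → ∃[ σ ] push σ ≡ τ
push-onto-𝔄 []       _                  τ≢[] = contradiction refl τ≢[]
push-onto-𝔄 (t ∷ ts) ((inv , _) , ≢1) _    =
  map unbump ts , cong₂ _∷_ (sym (IsInvSeq-head≡0 inv)) (map-bump-unbump (≢1 ∘ suc))

proposition4p2 : (τ : List ℕ) →
    (∃[ σ ] (InI010-102 σ × push σ ≡ τ)) ⇔ (InFrakA τ × ¬ (τ ≡ []))
proposition4p2 τ = mk⇔ image⊆𝔄 𝔄⊆image
  where
  open Equivalence using (to; from)

  image⊆𝔄 : ∃[ σ ] (InI010-102 σ × push σ ≡ τ) → InFrakA τ × ¬ (τ ≡ [])
  image⊆𝔄 (σ , σ∈I , refl) = (to push-InI010-102⇔ σ∈I , push≢1) , λ ()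

  𝔄⊆image : InFrakA τ × ¬ (τ ≡ []) → ∃[ σ ] (InI010-102 σ × push σ ≡ τ)
  𝔄⊆image (τ∈𝔄 , τ≢[]) =
    let σ , push-σ≡τ = push-onto-𝔄 τ τ∈𝔄 τ≢[]
    in  σ , from push-InI010-102⇔ (subst InI010-102 (sym push-σ≡τ) (proj₁ τ∈𝔄)) , push-σ≡τ
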